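{- Let $m\ge 2$ and let $G_{m,4}=S_m\Box P_4$ be the stacked-book graph. Then $im(G_{m,4})=m$.
   Context: $S_m$ is the star graph with one central vertex and $m-1$ leaves ($m$ vertices in total); $P_n$ is the path on $n$ vertices. The stacked-book graph $G_{m,n}=S_m\Box P_n$ consists of $n$ copies $S_m(1),\dots,S_m(n)$ of $S_m$, with each vertex of $S_m(i)$ joined to the corresponding vertex of $S_m(i+1)$ for $i\in[1,n-1]$. An induced matching of a graph $G$ is a set $M$ of edges such that no two edges of $M$ share an endpoint and no edge of $G$ joins an endpoint of one edge of $M$ to an endpoint of another edge of $M$; $im(G)$ is the maximum size of an induced matching of $G$. -}

module Defs where

open import Data.Nat using (ℕ; zero; suc; _≤_)
open import Data.Fin using (Fin; toℕ)
open import Data.Product using (_×_; _,_; proj₁; proj₂; ∃-syntax)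
open import Data.Sum using (_⊎_)
open import Data.List using (List; length; lookup)
open import Relation.Binary.PropositionalEquality using (_≡_; _≢_)
open import Relation.Nullary using (¬_)

StarAdj : {m : ℕ} → Fin m → Fin m → Set
StarAdj a b = (toℕ a ≡ 0 × toℕ b ≢ 0) ⊎ (toℕ a ≢ 0 × toℕ b ≡ 0)

PathAdj : {n : ℕ} → Fin n → Fin n → Set
PathAdj i j = (suc (toℕ i) ≡ toℕ j) ⊎ (suc (toℕ j) ≡ toℕ i)

Vertex : ℕ → ℕ → Set
Vertex m n = Fin m × Fin n

Adj : {m n : ℕ} → Vertex m n → Vertex m n → Set
Adj (a , i) (b , j) = (i ≡ j × StarAdj a b) ⊎ (a ≡ b × PathAdj i j)

Edge : ℕ → ℕ → Set
Edge m n = Vertex m n × Vertex m n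

IsEdge : {m n : ℕ} → Edge m n → Set
IsEdge (u , v) = Adj u v

Separated : {m n : ℕ} → Edge m n → Edge m n → Set
Separated (u , v) (x , y) =
  (u ≢ x × u ≢ y × v ≢ x × v ≢ y) ×
  (¬ Adj u x × ¬ Adj u y × ¬ Adj v x × ¬ Adj v y)

-- An induced matching, given as a list of edges; distinct list positions
-- carry separated edges (hence the edges are pairwise distinct and the
-- size of the matching is the length of the list).
IsInducedMatching : {m n : ℕ} → List (Edge m n) → Set
IsInducedMatching M =
  (∀ k → IsEdge (lookup M k)) ×
  (∀ k l → k ≢ l → Separated (lookup M k) (lookup M l))

ImEq : ℕ → ℕ → ℕ → Set
ImEq m n r =
  (∃[ M ] (IsInducedMatching {m} {n} M × length M ≡ r)) ×
  (∀ (M : List (Edge m n)) → IsInducedMatching M → length M ≤ r)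

-- A set of pairwise equal-or-adjacent vertices meets at most one edge of an induced
-- matching.  In every column a (the four copies of the vertex a of S_m, numbered
-- 0..3) choose a window of two consecutive copies; an induced matching all of whose
-- edges meet these m windows has at most m edges.  One of three choices always
-- works: if the matching uses the centre vertex of copy 2, windows {2,3} at the
-- centre and {0,1} at the leaves; else, if it uses the centre of copy 0, {0,1} and
-- {2,3}; else {2,3} and {1,2}.  The first window system is itself an induced matching
-- of size m.
module Submission where

open import Defs
open import Data.Nat using (ℕ; suc; _≤_)
open import Data.Nat.Properties using (suc-injective)
open import Data.Fin using (Fin; toℕ; zero; suc; inject₁; cast)
open import Data.Fin.Patterns using (0F; 1F; 2F; 3F)
open import Data.Fin.Properties
  using (_≟_; any?; injective⇒≤; toℕ-injective; toℕ-inject₁; cast-involutive)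
open import Data.Product using (_×_; _,_; proj₁; ∃-syntax)
open import Data.Product.Properties using (≡-dec)
open import Data.Sum using (_⊎_; inj₁; inj₂; [_,_]; swap)
open import Data.List using (List; length; lookup; tabulate)
open import Data.List.Properties using (length-tabulate; lookup-tabulate)
open import Data.Empty using (⊥; ⊥-elim)
open import Function using (id; _∘_)
open import Relation.Binary.PropositionalEquality
  using (_≡_; _≢_; refl; sym; trans; cong; subst; subst₂)
open import Relation.Nullary using (¬_; Dec; yes; no)
open import Relation.Nullary.Decidable using (_⊎-dec_)

private
  variable
    m n : ℕ

infix 4 _∈ₑ_ _⊆ₑ_

_∈ₑ_ : Vertex m n → Edge m n → Set
p ∈ₑ (u , v) = p ≡ u ⊎ p ≡ v

_⊆ₑ_ : Edge m n → Edge m n → Set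
e ⊆ₑ e′ = ∀ {p} → p ∈ₑ e → p ∈ₑ e′

_∈ₑ?_ : (p : Vertex m n) (e : Edge m n) → Dec (p ∈ₑ e)
p ∈ₑ? (u , v) = (p ≟ᵥ u) ⊎-dec (p ≟ᵥ v)
  where _≟ᵥ_ = ≡-dec _≟_ _≟_

Near : Vertex m n → Vertex m n → Set
Near p q = p ≡ q ⊎ Adj p q

Far : Vertex m n → Edge m n → Set
Far p e = ∀ {q} → q ∈ₑ e → ¬ Near p q

near-path : {a : Fin m} {i j : Fin n} → PathAdj i j → Near (a , i) (a , j)
near-path i~j = inj₂ (inj₂ (refl , i~j))

near-star : {a b : Fin m} {i : Fin n} → StarAdj a b → Near (a , i) (b , i)
near-star a~b = inj₂ (inj₁ (refl , a~b))

separated⇒far : ∀ {e e′ : Edge m n} {p} → Separated e e′ → p ∈ₑ e → Far p e′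
separated⇒far ((u≢x , _ , _ , _) , (u≁x , _ , _ , _)) (inj₁ refl) (inj₁ refl) = [ u≢x , u≁x ]
separated⇒far ((_ , u≢y , _ , _) , (_ , u≁y , _ , _)) (inj₁ refl) (inj₂ refl) = [ u≢y , u≁y ]
separated⇒far ((_ , _ , v≢x , _) , (_ , _ , v≁x , _)) (inj₂ refl) (inj₁ refl) = [ v≢x , v≁x ]
separated⇒far ((_ , _ , _ , v≢y) , (_ , _ , _ , v≁y)) (inj₂ refl) (inj₂ refl) = [ v≢y , v≁y ]

separated-from : {u v x y : Vertex m n} →
                 ¬ Near u x → ¬ Near u y → ¬ Near v x → ¬ Near v y → Separated (u , v) (x , y)
separated-from ux uy vx vy =
  (ux ∘ inj₁ , uy ∘ inj₁ , vx ∘ inj₁ , vy ∘ inj₁) , (ux ∘ inj₂ , uy ∘ inj₂ , vx ∘ inj₂ , vy ∘ inj₂)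

meets-or-far : ∀ {M : List (Edge m n)} {k p} → IsInducedMatching M → p ∈ₑ lookup M k →
               ∀ l → p ∈ₑ lookup M l ⊎ Far p (lookup M l)
meets-or-far {k = k} (_ , sep) p∈ l with k ≟ l
... | yes refl = inj₁ p∈
... | no k≢l  = inj₂ (separated⇒far (sep k l k≢l) p∈)

tabulate-isInducedMatching : ∀ {k} {f : Fin k → Edge m n} → (∀ a → IsEdge (f a)) →
                             (∀ a b → a ≢ b → Separated (f a) (f b)) →
                             IsInducedMatching (tabulate f)
tabulate-isInducedMatching {f = f} isEdge sep =
  (λ k → subst IsEdge (sym (lookup≡ k)) (isEdge (index k))) ,
  (λ k l k≢l → subst₂ Separated (sym (lookup≡ k)) (sym (lookup≡ l))
                 (sep (index k) (index l) (k≢l ∘ index-injective)))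
  where
  index : Fin (length (tabulate f)) → Fin _
  index = cast (length-tabulate f)

  unindex : ∀ k → cast (sym (length-tabulate f)) (index k) ≡ k
  unindex = cast-involutive (sym (length-tabulate f)) (length-tabulate f)

  lookup≡ : ∀ k → lookup (tabulate f) k ≡ f (index k)
  lookup≡ k = trans (cong (lookup (tabulate f)) (sym (unindex k))) (lookup-tabulate f (index k))

  index-injective : ∀ {k l} → index k ≡ index l → k ≡ l
  index-injective {k} {l} eq = trans (sym (unindex k)) (trans (cong (cast _) eq) (unindex l))

InWindow : (Fin m → ℕ) → Vertex m n → Set
InWindow low (a , i) = toℕ i ≡ low a ⊎ toℕ i ≡ suc (low a)

Covered : (Fin m → ℕ) → Edge m n → Set
Covered low e = ∃[ p ] (p ∈ₑ e × InWindow low p)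

covered-⊆ : ∀ {low : Fin m → ℕ} {e e′ : Edge m n} → e ⊆ₑ e′ → Covered low e → Covered low e′
covered-⊆ e⊆e′ (p , p∈ , p-in) = p , e⊆e′ p∈ , p-in

window-near : ∀ {low : Fin m → ℕ} {a} {i j : Fin n} →
              InWindow low (a , i) → InWindow low (a , j) → Near (a , i) (a , j)
window-near (inj₁ i≡) (inj₁ j≡) = inj₁ (cong (_ ,_) (toℕ-injective (trans i≡ (sym j≡))))
window-near (inj₁ i≡) (inj₂ j≡) = near-path (inj₁ (trans (cong suc i≡) (sym j≡)))
window-near (inj₂ i≡) (inj₁ j≡) = near-path (inj₂ (trans (cong suc j≡) (sym i≡)))
window-near (inj₂ i≡) (inj₂ j≡) = inj₁ (cong (_ ,_) (toℕ-injective (trans i≡ (sym j≡))))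

covered⇒length≤ : ∀ {M : List (Edge m n)} (low : Fin m → ℕ) → IsInducedMatching M →
                  (∀ k → Covered low (lookup M k)) → length M ≤ m
covered⇒length≤ {M = M} low (_ , sep) covered = injective⇒≤ column-injective
  where
  column : Fin (length M) → Fin _
  column k = proj₁ (proj₁ (covered k))

  same-column-clash : ∀ {e e′ : Edge _ _} (c : Covered low e) (c′ : Covered low e′) →
                      proj₁ (proj₁ c) ≡ proj₁ (proj₁ c′) → (∀ {p} → p ∈ₑ e → Far p e′) → ⊥
  same-column-clash (_ , p∈ , p-in) (_ , q∈ , q-in) refl far =
    far p∈ q∈ (window-near {low = low} p-in q-in)

  column-injective : ∀ {k l} → column k ≡ column l → k ≡ l
  column-injective {k} {l} eq with k ≟ l
  ... | yes k≡l = k≡l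
  ... | no k≢l  =
    ⊥-elim (same-column-clash (covered k) (covered l) eq (separated⇒far (sep k l k≢l)))

consecutive : {i j : Fin (suc n)} → suc (toℕ i) ≡ toℕ j → ∃[ k ] (i ≡ inject₁ k × j ≡ suc k)
consecutive {i = zero}  {j = suc zero}    refl = zero , refl , refl
consecutive {n = suc _} {i = suc _} {j = suc _} eq with consecutive (suc-injective eq)
... | k , refl , refl = suc k , refl , refl

-- The edges of S_{n+1} □ P_4 up to orientation; leaf b of the star is the vertex suc b.
data Shape (n : ℕ) : Set where
  spoke  : Fin n → Fin 4 → Shape n
  strand : Fin (suc n) → Fin 3 → Shape n

edgeOf : Shape n → Edge (suc n) 4
edgeOf (spoke b i)  = (0F , i) , (suc b , i)
edgeOf (strand a j) = (a , inject₁ j) , (a , suc j)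

centre~leaf : {b : Fin n} → StarAdj {suc n} 0F (suc b)
centre~leaf = inj₁ (refl , λ ())

edgeOf-isEdge : (s : Shape n) → IsEdge (edgeOf s)
edgeOf-isEdge (spoke b i)  = inj₁ (refl , centre~leaf)
edgeOf-isEdge (strand a j) = inj₂ (refl , inj₁ (cong suc (toℕ-inject₁ j)))

classify : {e : Edge (suc n) 4} → IsEdge e → ∃[ s ] (edgeOf s ⊆ₑ e)
classify {e = (0F    , i) , (suc b , _)} (inj₁ (refl , _)) = spoke b i , id
classify {e = (suc b , i) , (0F    , _)} (inj₁ (refl , _)) = spoke b i , swap
classify {e = (0F    , _) , (0F    , _)} (inj₁ (refl , inj₁ (_ , ≢0))) = ⊥-elim (≢0 refl)
classify {e = (0F    , _) , (0F    , _)} (inj₁ (refl , inj₂ (≢0 , _))) = ⊥-elim (≢0 refl)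
classify {e = (suc _ , _) , (suc _ , _)} (inj₁ (refl , inj₁ (() , _)))
classify {e = (suc _ , _) , (suc _ , _)} (inj₁ (refl , inj₂ (_ , ())))
classify {e = (a , _) , _} (inj₂ (refl , inj₁ up)) with consecutive up
... | k , refl , refl = strand a k , id
classify {e = (a , _) , _} (inj₂ (refl , inj₂ down)) with consecutive down
... | k , refl , refl = strand a k , swap

starWindows : ℕ → ℕ → Fin (suc n) → ℕ
starWindows centre leaf 0F      = centre
starWindows centre leaf (suc _) = leaf

centre₀ centre₂ : Vertex (suc n) 4
centre₀ = 0F , 0F
centre₂ = 0F , 2F

∌centre₀⇒covered : {e : Edge (suc n) 4} → IsEdge e → ¬ centre₀ ∈ₑ e → Covered (starWindows 2 1) e
∌centre₀⇒covered isEdge ∌c₀ with classify isEdge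
... | s , s⊆e = covered-⊆ s⊆e (shape-covered s (∌c₀ ∘ s⊆e))
  where
  shape-covered : (s : Shape _) → ¬ centre₀ ∈ₑ edgeOf s → Covered (starWindows 2 1) (edgeOf s)
  shape-covered (spoke _ 0F)       ∌c₀ = ⊥-elim (∌c₀ (inj₁ refl))
  shape-covered (spoke _ 1F)       _   = _ , inj₂ refl , inj₁ refl
  shape-covered (spoke _ 2F)       _   = _ , inj₂ refl , inj₂ refl
  shape-covered (spoke _ 3F)       _   = _ , inj₁ refl , inj₂ refl
  shape-covered (strand 0F 0F)     ∌c₀ = ⊥-elim (∌c₀ (inj₁ refl))
  shape-covered (strand 0F 1F)     _   = _ , inj₂ refl , inj₁ refl
  shape-covered (strand 0F 2F)     _   = _ , inj₁ refl , inj₁ refl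
  shape-covered (strand (suc _) 0F) _  = _ , inj₂ refl , inj₁ refl
  shape-covered (strand (suc _) 1F) _  = _ , inj₁ refl , inj₁ refl
  shape-covered (strand (suc _) 2F) _  = _ , inj₁ refl , inj₂ refl

far-centre₀⇒covered : {e : Edge (suc n) 4} → IsEdge e → ¬ centre₂ ∈ₑ e → Far centre₀ e →
                      Covered (starWindows 0 2) e
far-centre₀⇒covered isEdge ∌c₂ far with classify isEdge
... | s , s⊆e = covered-⊆ s⊆e (shape-covered s (∌c₂ ∘ s⊆e) (far ∘ s⊆e))
  where
  shape-covered : (s : Shape _) → ¬ centre₂ ∈ₑ edgeOf s → Far centre₀ (edgeOf s) →
                  Covered (starWindows 0 2) (edgeOf s)
  shape-covered (spoke _ 0F)        _   far = ⊥-elim (far (inj₁ refl) (inj₁ refl))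
  shape-covered (spoke _ 1F)        _   far = ⊥-elim (far (inj₁ refl) (near-path (inj₁ refl)))
  shape-covered (spoke _ 2F)        _   _   = _ , inj₂ refl , inj₁ refl
  shape-covered (spoke _ 3F)        _   _   = _ , inj₂ refl , inj₂ refl
  shape-covered (strand 0F 0F)      _   far = ⊥-elim (far (inj₁ refl) (inj₁ refl))
  shape-covered (strand 0F 1F)      _   far = ⊥-elim (far (inj₁ refl) (near-path (inj₁ refl)))
  shape-covered (strand 0F 2F)      ∌c₂ _   = ⊥-elim (∌c₂ (inj₁ refl))
  shape-covered (strand (suc _) 0F) _   far = ⊥-elim (far (inj₁ refl) (near-star centre~leaf))
  shape-covered (strand (suc _) 1F) _   _   = _ , inj₂ refl , inj₁ refl
  shape-covered (strand (suc _) 2F) _   _   = _ , inj₁ refl , inj₁ refl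

far-centre₂⇒covered : {e : Edge (suc n) 4} → IsEdge e → Far centre₂ e → Covered (starWindows 2 0) e
far-centre₂⇒covered isEdge far with classify isEdge
... | s , s⊆e = covered-⊆ s⊆e (shape-covered s (far ∘ s⊆e))
  where
  shape-covered : (s : Shape _) → Far centre₂ (edgeOf s) → Covered (starWindows 2 0) (edgeOf s)
  shape-covered (spoke _ 0F)        _   = _ , inj₂ refl , inj₁ refl
  shape-covered (spoke _ 1F)        far = ⊥-elim (far (inj₁ refl) (near-path (inj₂ refl)))
  shape-covered (spoke _ 2F)        far = ⊥-elim (far (inj₁ refl) (inj₁ refl))
  shape-covered (spoke _ 3F)        far = ⊥-elim (far (inj₁ refl) (near-path (inj₁ refl)))
  shape-covered (strand 0F 0F)      far = ⊥-elim (far (inj₂ refl) (near-path (inj₂ refl)))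
  shape-covered (strand 0F 1F)      far = ⊥-elim (far (inj₂ refl) (inj₁ refl))
  shape-covered (strand 0F 2F)      far = ⊥-elim (far (inj₁ refl) (inj₁ refl))
  shape-covered (strand (suc _) 0F) _   = _ , inj₁ refl , inj₁ refl
  shape-covered (strand (suc _) 1F) far = ⊥-elim (far (inj₂ refl) (near-star centre~leaf))
  shape-covered (strand (suc _) 2F) far = ⊥-elim (far (inj₁ refl) (near-star centre~leaf))

inducedMatching-length≤ : (M : List (Edge (suc n) 4)) → IsInducedMatching M → length M ≤ suc n
inducedMatching-length≤ M im@(isEdge , _) with any? (λ k → centre₂ ∈ₑ? lookup M k)
... | yes (k , c₂∈) =
  covered⇒length≤ {M = M} (starWindows 2 0) im λ l →
    [ (λ c₂∈l → centre₂ , c₂∈l , inj₁ refl) , far-centre₂⇒covered (isEdge l) ]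
      (meets-or-far {M = M} im c₂∈ l)
... | no ∌c₂ with any? (λ k → centre₀ ∈ₑ? lookup M k)
...   | yes (k , c₀∈) =
  covered⇒length≤ {M = M} (starWindows 0 2) im λ l →
    [ (λ c₀∈l → centre₀ , c₀∈l , inj₁ refl) , far-centre₀⇒covered (isEdge l) (∌c₂ ∘ (l ,_)) ]
      (meets-or-far {M = M} im c₀∈ l)
...   | no ∌c₀ =
  covered⇒length≤ {M = M} (starWindows 2 1) im λ l →
    ∌centre₀⇒covered (isEdge l) (∌c₀ ∘ (l ,_))

windowStrand : Fin (suc n) → Shape n
windowStrand 0F      = strand 0F 2F
windowStrand (suc b) = strand (suc b) 0F

distinct-columns-levels-apart : {a a′ : Fin m} {i j : Fin n} → a ≢ a′ → i ≢ j →
                                ¬ Near (a , i) (a′ , j)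
distinct-columns-levels-apart a≢a′ _   (inj₁ refl)             = a≢a′ refl
distinct-columns-levels-apart _    i≢j (inj₂ (inj₁ (i≡j , _))) = i≢j i≡j
distinct-columns-levels-apart a≢a′ _   (inj₂ (inj₂ (a≡a′ , _))) = a≢a′ a≡a′

distinct-leaves-apart : {b c : Fin n} {i j : Fin 4} → b ≢ c → ¬ Near {suc n} (suc b , i) (suc c , j)
distinct-leaves-apart b≢c (inj₁ refl)                         = b≢c refl
distinct-leaves-apart _   (inj₂ (inj₁ (_ , inj₁ (() , _))))
distinct-leaves-apart _   (inj₂ (inj₁ (_ , inj₂ (_ , ()))))
distinct-leaves-apart b≢c (inj₂ (inj₂ (refl , _)))            = b≢c refl

windowStrands-separated : (a a′ : Fin (suc n)) → a ≢ a′ →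
                          Separated (edgeOf (windowStrand a)) (edgeOf (windowStrand a′))
windowStrands-separated 0F      0F      a≢a′ = ⊥-elim (a≢a′ refl)
windowStrands-separated 0F      (suc _) _    =
  separated-from (apart (λ ()) (λ ())) (apart (λ ()) (λ ()))
                 (apart (λ ()) (λ ())) (apart (λ ()) (λ ()))
  where apart = distinct-columns-levels-apart
windowStrands-separated (suc _) 0F      _    =
  separated-from (apart (λ ()) (λ ())) (apart (λ ()) (λ ()))
                 (apart (λ ()) (λ ())) (apart (λ ()) (λ ()))
  where apart = distinct-columns-levels-apart
windowStrands-separated (suc b) (suc c) a≢a′ = separated-from apart apart apart apart
  where
  apart : ∀ {i j} → ¬ Near (suc b , i) (suc c , j)
  apart = distinct-leaves-apart (a≢a′ ∘ cong suc)

windowMatching : List (Edge (suc n) 4)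
windowMatching = tabulate (edgeOf ∘ windowStrand)

windowMatching-isInducedMatching : IsInducedMatching (windowMatching {n})
windowMatching-isInducedMatching =
  tabulate-isInducedMatching (edgeOf-isEdge ∘ windowStrand) windowStrands-separated

-- The argument works for every m ≥ 1.
theorem7 : (m : ℕ) → 2 ≤ m → ImEq m 4 m
theorem7 (suc n) _ =
  (windowMatching , windowMatching-isInducedMatching , length-tabulate (edgeOf ∘ windowStrand)) ,
  inducedMatching-length≤
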